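{- For every $n>1$, $\mathfrak{A}_n\subsetneq \mathfrak{A}_{\mathcal{P}_n}\subsetneq S_n^3$.
   Context: A Latin square of order $n$ is an $n\times n$ array with entries in $[n]$ in which each symbol occurs exactly once in each row and column; a partial Latin square of order $n$ is an $n\times n$ array whose cells are empty or contain a symbol of $[n]$, each symbol at most once per row and column (non-empty: some cell filled). For $\Theta=(\alpha,\beta,\gamma)\in S_n^3$ and a (partial) Latin square $P$ with orthogonal representation $O(P)=\{(r,c,s):\text{cell }(r,c)\text{ contains }s\}$, $P^\Theta$ is defined by $O(P^\Theta)=\{(\alpha(r),\beta(c),\gamma(s)):(r,c,s)\in O(P)\}$, and $\Theta$ is an autotopism of $P$ if $P^\Theta=P$. $\mathfrak{A}_n$ is the set of $\Theta\in S_n^3$ which are autotopisms of at least one Latin square of order $n$, and $\mathfrak{A}_{\mathcal{P}_n}$ is the set of $\Theta\in S_n^3$ which are autotopisms of at least one non-empty partial Latin square of order $n$. -}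

module Defs where

open import Data.Nat using (ℕ)
open import Data.Fin using (Fin)
open import Data.Maybe using (Maybe; just)
open import Data.Product using (Σ; ∃; ∃-syntax; _×_; _,_)
open import Data.Unit using (⊤)
open import Relation.Nullary using (¬_)
open import Relation.Binary.PropositionalEquality using (_≡_)
open import Function.Bundles using (_⇔_)
open import Data.Fin.Permutation using (Permutation′; _⟨$⟩ʳ_)

S³ : ℕ → Set
S³ n = Permutation′ n × Permutation′ n × Permutation′ n

∃! : {A : Set} → (A → Set) → Set
∃! {A} P = Σ A λ x → P x × (∀ y → P y → x ≡ y)

-- Latin square of order n: symbols [n] = Fin n, every cell filled,
-- each symbol exactly once in each row and in each column
LatinSquare : ℕ → Set
LatinSquare n = Fin n → Fin n → Fin n

IsLatin : ∀ {n} → LatinSquare n → Set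
IsLatin {n} L =
  (∀ (r s : Fin n) → ∃! λ c → L r c ≡ s) ×
  (∀ (c s : Fin n) → ∃! λ r → L r c ≡ s)

PartialSquare : ℕ → Set
PartialSquare n = Fin n → Fin n → Maybe (Fin n)

IsPartialLatin : ∀ {n} → PartialSquare n → Set
IsPartialLatin {n} P =
  (∀ (r c c' s : Fin n) → P r c ≡ just s → P r c' ≡ just s → c ≡ c') ×
  (∀ (r r' c s : Fin n) → P r c ≡ just s → P r' c ≡ just s → r ≡ r')

NonEmpty : ∀ {n} → PartialSquare n → Set
NonEmpty {n} P = Σ (Fin n) λ r → Σ (Fin n) λ c → Σ (Fin n) λ s → P r c ≡ just s

-- orthogonal representations, as predicates on triples
Triple : ℕ → Set
Triple n = Fin n × Fin n × Fin n

O : ∀ {n} → PartialSquare n → Triple n → Set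
O P (r , c , s) = P r c ≡ just s

OL : ∀ {n} → LatinSquare n → Triple n → Set
OL L (r , c , s) = L r c ≡ s

_^_ : ∀ {n} → (Triple n → Set) → S³ n → (Triple n → Set)
(X ^ (α , β , γ)) (r' , c' , s') =
  ∃[ r ] ∃[ c ] ∃[ s ] (X (r , c , s) ×
    (α ⟨$⟩ʳ r ≡ r') × (β ⟨$⟩ʳ c ≡ c') × (γ ⟨$⟩ʳ s ≡ s'))

_≐_ : ∀ {n} → (Triple n → Set) → (Triple n → Set) → Set
X ≐ Y = ∀ t → X t ⇔ Y t

IsAutotopismL : ∀ {n} → S³ n → LatinSquare n → Set
IsAutotopismL Θ L = (OL L ^ Θ) ≐ OL L

IsAutotopismP : ∀ {n} → S³ n → PartialSquare n → Set
IsAutotopismP Θ P = (O P ^ Θ) ≐ O P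

𝔄 : (n : ℕ) → S³ n → Set
𝔄 n Θ = Σ (LatinSquare n) λ L → IsLatin L × IsAutotopismL Θ L

𝔄𝒫 : (n : ℕ) → S³ n → Set
𝔄𝒫 n Θ = Σ (PartialSquare n) λ P →
  IsPartialLatin P × NonEmpty P × IsAutotopismP Θ P

Full : (n : ℕ) → S³ n → Set
Full n Θ = ⊤

_⊊_ : ∀ {n} → (S³ n → Set) → (S³ n → Set) → Set
A ⊊ B = (∀ Θ → A Θ → B Θ) × ∃[ Θ ] (B Θ × ¬ A Θ)

-- A Latin square is a non-empty partial Latin square with the same autotopisms,
-- so 𝔄 n ⊆ 𝔄𝒫 n. An autotopism (id, id, γ) sends each entry (r, c, s) to
-- (r, c, γ s), so γ fixes every symbol that occurs: all symbols of a Latin square,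
-- at least one of a non-empty partial one. Hence (id, id, γ) with γ a derangement
-- lies outside 𝔄𝒫 n, and for n ≥ 3 the transposition γ = (0 1) gives an element of
-- 𝔄𝒫 n (the square with the single entry (0, 0, 2)) outside 𝔄 n. For n = 2 no such
-- γ exists; there ((0 1), (0 1), (0 1)) fixes the partial square with entries
-- (i, i, i), but every Latin square of order 2 has a constant diagonal, which the
-- symbol transposition would have to move.

module Submission where

open import Defs
open import Data.Nat using (ℕ; _>_; zero; suc; s≤s; z≤n)
open import Data.Fin using (Fin; _≟_) renaming (suc to fsuc)
open import Data.Fin.Properties using () renaming (suc-injective to fsuc-injective)
open import Data.Fin.Patterns using (0F; 1F; 2F)
open import Data.Fin.Permutation
  using (Permutation′; _⟨$⟩ʳ_; _⟨$⟩ˡ_; inverseʳ; transpose; lift₀; _∘ₚ_)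
  renaming (id to idₚ)
open import Data.Maybe using (just; nothing)
open import Data.Maybe.Properties using (just-injective)
open import Data.Product using (∃-syntax; _×_; _,_)
open import Data.Unit using (tt)
open import Function.Bundles using (mk⇔; Equivalence)
open import Function.Construct.Composition using (_⇔-∘_)
open import Function.Construct.Symmetry using (⇔-sym)
open import Relation.Nullary using (¬_; yes; no; contradiction)
open import Relation.Binary.PropositionalEquality
  using (_≡_; _≢_; refl; sym; trans; cong; module ≡-Reasoning)

private
  variable
    n : ℕ

∃!-unique : {A : Set} {P : A → Set} → ∃! P → ∀ {x y} → P x → P y → x ≡ y
∃!-unique (_ , _ , unique) px py = trans (sym (unique _ px)) (unique _ py)

≐-trans : {X Y Z : Triple n → Set} → X ≐ Y → Y ≐ Z → X ≐ Z
≐-trans X≐Y Y≐Z t = Y≐Z t ⇔-∘ X≐Y t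

≐-sym : {X Y : Triple n → Set} → X ≐ Y → Y ≐ X
≐-sym X≐Y t = ⇔-sym (X≐Y t)

^-cong : ∀ {X Y : Triple n → Set} Θ → X ≐ Y → (X ^ Θ) ≐ (Y ^ Θ)
^-cong Θ X≐Y t = mk⇔
  (λ (r , c , s , x , eqs) → r , c , s , Equivalence.to (X≐Y (r , c , s)) x , eqs)
  (λ (r , c , s , y , eqs) → r , c , s , Equivalence.from (X≐Y (r , c , s)) y , eqs)

^-image : ∀ {X : Triple n → Set} α β γ → (X ^ (α , β , γ)) ≐ X →
          ∀ {r c s} → X (r , c , s) → X (α ⟨$⟩ʳ r , β ⟨$⟩ʳ c , γ ⟨$⟩ʳ s)
^-image α β γ aut {r} {c} {s} x = Equivalence.to (aut _) (r , c , s , x , refl , refl , refl)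

autotopismL-image : ∀ α β γ {L : LatinSquare n} → IsAutotopismL (α , β , γ) L →
                    ∀ r c → L (α ⟨$⟩ʳ r) (β ⟨$⟩ʳ c) ≡ γ ⟨$⟩ʳ L r c
autotopismL-image α β γ {L} aut r c = ^-image {X = OL L} α β γ aut {r} {c} refl

autotopismP-image : ∀ α β γ {P : PartialSquare n} → IsAutotopismP (α , β , γ) P →
                    ∀ {r c s} → P r c ≡ just s → P (α ⟨$⟩ʳ r) (β ⟨$⟩ʳ c) ≡ just (γ ⟨$⟩ʳ s)
autotopismP-image α β γ {P} aut {r} {c} = ^-image {X = O P} α β γ aut {r} {c}

toPartial : LatinSquare n → PartialSquare n
toPartial L r c = just (L r c)

O-toPartial : (L : LatinSquare n) → O (toPartial L) ≐ OL L
O-toPartial L t = mk⇔ just-injective (cong just)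

toPartial-isPartialLatin : {L : LatinSquare n} → IsLatin L → IsPartialLatin (toPartial L)
toPartial-isPartialLatin (rows , cols) =
  (λ r c c′ s e e′ → ∃!-unique (rows r s) (just-injective e) (just-injective e′)) ,
  (λ r r′ c s e e′ → ∃!-unique (cols c s) (just-injective e) (just-injective e′))

toPartial-autotopism : ∀ {Θ} {L : LatinSquare n} →
                       IsAutotopismL Θ L → IsAutotopismP Θ (toPartial L)
toPartial-autotopism {Θ = Θ} {L} aut =
  ≐-trans {X = O P ^ Θ} {OL L ^ Θ} {O P} (^-cong Θ (O-toPartial L))
    (≐-trans {X = OL L ^ Θ} {OL L} {O P} aut (≐-sym {X = O P} (O-toPartial L)))
  where
  P = toPartial L

𝔄⊆𝔄𝒫 : Fin n → ∀ Θ → 𝔄 n Θ → 𝔄𝒫 n Θ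
𝔄⊆𝔄𝒫 r Θ (L , latin , aut) =
  toPartial L , toPartial-isPartialLatin {L = L} latin , (r , r , L r r , refl) ,
  toPartial-autotopism {Θ = Θ} {L} aut

𝔄-idid⇒id : ∀ γ → 𝔄 n (idₚ , idₚ , γ) → ∀ s → γ ⟨$⟩ʳ s ≡ s
𝔄-idid⇒id γ (L , (rows , _) , aut) s with rows s s
... | c , Lsc≡s , _ = begin
  γ ⟨$⟩ʳ s        ≡⟨ cong (γ ⟨$⟩ʳ_) (sym Lsc≡s) ⟩
  γ ⟨$⟩ʳ L s c    ≡⟨ sym (autotopismL-image idₚ idₚ γ aut s c) ⟩
  L s c          ≡⟨ Lsc≡s ⟩
  s              ∎
  where open ≡-Reasoning

𝔄𝒫-idid⇒fixedPoint : ∀ γ → 𝔄𝒫 n (idₚ , idₚ , γ) → ∃[ s ] γ ⟨$⟩ʳ s ≡ s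
𝔄𝒫-idid⇒fixedPoint γ (P , _ , (r , c , s , Prc≡s) , aut) =
  s , just-injective (trans (sym (autotopismP-image idₚ idₚ γ aut Prc≡s)) Prc≡s)

singleton : Fin n → Fin n → Fin n → PartialSquare n
singleton r₀ c₀ s₀ r c with r ≟ r₀ | c ≟ c₀
... | yes _ | yes _ = just s₀
... | _     | _     = nothing

singleton-at : (r₀ c₀ s₀ : Fin n) → singleton r₀ c₀ s₀ r₀ c₀ ≡ just s₀
singleton-at r₀ c₀ s₀ with r₀ ≟ r₀ | c₀ ≟ c₀
... | yes _ | yes _  = refl
... | no r≢r | _     = contradiction refl r≢r
... | yes _ | no c≢c = contradiction refl c≢c

singleton-entry : ∀ {r₀ c₀ s₀ r c s : Fin n} → singleton r₀ c₀ s₀ r c ≡ just s →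
                  r ≡ r₀ × c ≡ c₀ × s ≡ s₀
singleton-entry {r₀ = r₀} {c₀} {r = r} {c} e with r ≟ r₀ | c ≟ c₀
singleton-entry refl | yes r≡r₀ | yes c≡c₀ = r≡r₀ , c≡c₀ , refl
singleton-entry ()   | yes _    | no _
singleton-entry ()   | no _     | _

singleton-isPartialLatin : (r₀ c₀ s₀ : Fin n) → IsPartialLatin (singleton r₀ c₀ s₀)
singleton-isPartialLatin r₀ c₀ s₀ =
  (λ r c c′ s e e′ → let _ , c≡c₀ , _ = singleton-entry e ; _ , c′≡c₀ , _ = singleton-entry e′
                     in trans c≡c₀ (sym c′≡c₀)) ,
  (λ r r′ c s e e′ → let r≡r₀ , _ = singleton-entry e ; r′≡r₀ , _ = singleton-entry e′
                     in trans r≡r₀ (sym r′≡r₀))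

singleton-autotopism : ∀ {α β γ} {r₀ c₀ s₀ : Fin n} →
                       α ⟨$⟩ʳ r₀ ≡ r₀ → β ⟨$⟩ʳ c₀ ≡ c₀ → γ ⟨$⟩ʳ s₀ ≡ s₀ →
                       IsAutotopismP (α , β , γ) (singleton r₀ c₀ s₀)
singleton-autotopism {α = α} {β} {γ} {r₀} {c₀} {s₀} fixα fixβ fixγ t = mk⇔ to from
  where
  to : (O (singleton r₀ c₀ s₀) ^ (α , β , γ)) t → O (singleton r₀ c₀ s₀) t
  to (r , c , s , e , refl , refl , refl) with singleton-entry e
  ... | refl , refl , refl rewrite fixα | fixβ | fixγ = singleton-at r₀ c₀ s₀
  from : O (singleton r₀ c₀ s₀) t → (O (singleton r₀ c₀ s₀) ^ (α , β , γ)) t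
  from e with singleton-entry e
  ... | refl , refl , refl = r₀ , c₀ , s₀ , singleton-at r₀ c₀ s₀ , fixα , fixβ , fixγ

fixedTriple⇒𝔄𝒫 : ∀ α β γ (r c s : Fin n) →
                 α ⟨$⟩ʳ r ≡ r → β ⟨$⟩ʳ c ≡ c → γ ⟨$⟩ʳ s ≡ s → 𝔄𝒫 n (α , β , γ)
fixedTriple⇒𝔄𝒫 α β γ r c s fixα fixβ fixγ =
  singleton r c s , singleton-isPartialLatin r c s , (r , c , s , singleton-at r c s) ,
  singleton-autotopism {α = α} {β} {γ} fixα fixβ fixγ

diagonal : PartialSquare n
diagonal r c with r ≟ c
... | yes _ = just r
... | no _  = nothing

diagonal-at : (r : Fin n) → diagonal r r ≡ just r
diagonal-at r with r ≟ r
... | yes _  = refl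
... | no r≢r = contradiction refl r≢r

diagonal-entry : ∀ {r c s : Fin n} → diagonal r c ≡ just s → c ≡ r × s ≡ r
diagonal-entry {r = r} {c} e with r ≟ c
diagonal-entry refl | yes r≡c = sym r≡c , refl
diagonal-entry ()   | no _

diagonal-isPartialLatin : IsPartialLatin (diagonal {n})
diagonal-isPartialLatin =
  (λ r c c′ s e e′ → let c≡r , _ = diagonal-entry e ; c′≡r , _ = diagonal-entry e′
                     in trans c≡r (sym c′≡r)) ,
  (λ r r′ c s e e′ → let _ , s≡r = diagonal-entry e ; _ , s≡r′ = diagonal-entry e′
                     in trans (sym s≡r) s≡r′)

diagonal-autotopism : (π : Permutation′ n) → IsAutotopismP (π , π , π) diagonal
diagonal-autotopism π t = mk⇔ to from
  where
  to : (O diagonal ^ (π , π , π)) t → O diagonal t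
  to (r , c , s , e , refl , refl , refl) with diagonal-entry e
  ... | refl , refl = diagonal-at (π ⟨$⟩ʳ r)
  from : O diagonal t → (O diagonal ^ (π , π , π)) t
  from e with diagonal-entry e
  ... | refl , refl = let r = π ⟨$⟩ˡ _ in
    r , r , r , diagonal-at r , inverseʳ π , inverseʳ π , inverseʳ π

automorphism∈𝔄𝒫 : Fin n → (π : Permutation′ n) → 𝔄𝒫 n (π , π , π)
automorphism∈𝔄𝒫 r π =
  diagonal , diagonal-isPartialLatin , (r , r , r , diagonal-at r) , diagonal-autotopism π

τ₂ : Permutation′ 2
τ₂ = transpose 0F 1F

τ₂-derangement : ∀ x → τ₂ ⟨$⟩ʳ x ≢ x
τ₂-derangement 0F ()
τ₂-derangement 1F ()

≢⇒≡τ₂ : ∀ {x y : Fin 2} → x ≢ y → x ≡ τ₂ ⟨$⟩ʳ y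
≢⇒≡τ₂ {0F} {0F} x≢y = contradiction refl x≢y
≢⇒≡τ₂ {0F} {1F} _   = refl
≢⇒≡τ₂ {1F} {0F} _   = refl
≢⇒≡τ₂ {1F} {1F} x≢y = contradiction refl x≢y

latin₂-diagonal : {L : LatinSquare 2} → IsLatin L → L 0F 0F ≡ L 1F 1F
latin₂-diagonal {L} (rows , cols) =
  trans (≢⇒≡τ₂ L00≢L01) (sym (≢⇒≡τ₂ L11≢L01))
  where
  L00≢L01 : L 0F 0F ≢ L 0F 1F
  L00≢L01 eq with ∃!-unique (rows 0F (L 0F 1F)) eq refl
  ... | ()
  L11≢L01 : L 1F 1F ≢ L 0F 1F
  L11≢L01 eq with ∃!-unique (cols 1F (L 0F 1F)) eq refl
  ... | ()

τ₂τ₂τ₂∉𝔄 : ¬ 𝔄 2 (τ₂ , τ₂ , τ₂)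
τ₂τ₂τ₂∉𝔄 (L , latin , aut) = τ₂-derangement (L 1F 1F) (sym (begin
  L 1F 1F            ≡⟨ autotopismL-image τ₂ τ₂ τ₂ aut 0F 0F ⟩
  τ₂ ⟨$⟩ʳ L 0F 0F    ≡⟨ cong (τ₂ ⟨$⟩ʳ_) (latin₂-diagonal latin) ⟩
  τ₂ ⟨$⟩ʳ L 1F 1F    ∎))
  where open ≡-Reasoning

cycle : ∀ m → Permutation′ (suc (suc m))
cycle zero    = transpose 0F 1F
cycle (suc m) = transpose 0F 1F ∘ₚ lift₀ (cycle m)

cycle-derangement : ∀ m i → cycle m ⟨$⟩ʳ i ≢ i
cycle-derangement zero    0F ()
cycle-derangement zero    1F ()
cycle-derangement (suc m) 0F ()
cycle-derangement (suc m) 1F ()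
cycle-derangement (suc m) (fsuc (fsuc i)) eq = cycle-derangement m (fsuc i) (fsuc-injective eq)

𝔄𝒫⊈𝔄 : ∀ m → ∃[ Θ ] (𝔄𝒫 (suc (suc m)) Θ × ¬ 𝔄 (suc (suc m)) Θ)
𝔄𝒫⊈𝔄 zero    = (τ₂ , τ₂ , τ₂) , automorphism∈𝔄𝒫 0F τ₂ , τ₂τ₂τ₂∉𝔄
𝔄𝒫⊈𝔄 (suc k) = (idₚ , idₚ , τ) , fixedTriple⇒𝔄𝒫 idₚ idₚ τ 0F 0F 2F refl refl refl ,
                λ a → 0F≢1F (sym (𝔄-idid⇒id τ a 0F))
  where
  τ = transpose 0F 1F
  0F≢1F : 0F ≢ 1F
  0F≢1F ()

𝔄⊊𝔄𝒫 : ∀ m → 𝔄 (suc (suc m)) ⊊ 𝔄𝒫 (suc (suc m))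
𝔄⊊𝔄𝒫 m = 𝔄⊆𝔄𝒫 0F , 𝔄𝒫⊈𝔄 m

𝔄𝒫⊊Full : ∀ m → 𝔄𝒫 (suc (suc m)) ⊊ Full (suc (suc m))
𝔄𝒫⊊Full m = (λ _ _ → tt) , (idₚ , idₚ , cycle m) , tt , λ a →
  let s , fixed = 𝔄𝒫-idid⇒fixedPoint (cycle m) a in cycle-derangement m s fixed

proposition3 : ∀ (n : ℕ) → n > 1 → (𝔄 n ⊊ 𝔄𝒫 n) × (𝔄𝒫 n ⊊ Full n)
proposition3 (suc (suc m)) (s≤s (s≤s z≤n)) = 𝔄⊊𝔄𝒫 m , 𝔄𝒫⊊Full m
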